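{- Let $\mathfrak g$ be a simple complex Lie algebra of type $A_n$, $C_n$, $B_{n+1}$ or $D_{n+2}$, let $\lambda\in\mathcal P^+$, $k\ge1$ and $\boldsymbol\lambda,\boldsymbol\mu\in\mathcal P^+(\lambda,k)$. If $\iota(\boldsymbol\lambda)\preceq\iota(\boldsymbol\mu)$, then $\boldsymbol\lambda\trianglelefteq\boldsymbol\mu$.
   Context: $\mathcal P^+=\mathbb Z_{\ge0}^n$ with standard basis $\omega_i$ and coordinate functionals $\omega_i^*$; $\mathcal P^+(\lambda,k)$ is the set of $k$-tuples in $\mathcal P^+$ summing to $\lambda$; $r_{(i,j),\ell}(\boldsymbol\lambda)=\min\{\sum_{t=i}^j\omega_t^*(\lambda_{n_1}+\dots+\lambda_{n_\ell}):1\le n_1<\dots<n_\ell\le k\}$ for $1\le i\le j\le n$, $1\le \ell\le k$, and $\boldsymbol\lambda\trianglelefteq\boldsymbol\mu$ iff $r_{(i,j),\ell}(\boldsymbol\lambda)\le r_{(i,j),\ell}(\boldsymbol\mu)$ for all $i\le j,\ell$. For $\mathfrak g$ with positive roots $R^+$, coroots $h_\alpha$, dominant integral weights $P^+$, and $\nu\in P^+$, $P^+(\nu,k)$ is the set of $k$-tuples of dominant weights summing to $\nu$; for $\alpha\in R^+$, $r_{\alpha,\ell}(\boldsymbol\nu)=\min\{(\nu_{i_1}+\dots+\nu_{i_\ell})(h_\alpha):1\le i_1<\dots<i_\ell\le k\}$, and $\boldsymbol\nu\preceq\boldsymbol\eta$ iff $r_{\alpha,\ell}(\boldsymbol\nu)\le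 r_{\alpha,\ell}(\boldsymbol\eta)$ for all $\alpha\in R^+$, $1\le\ell\le k$. The map $\iota:\mathcal P^+\to P^+$ sends $\omega_i$ to the $i$-th fundamental weight (Bourbaki labelling), $1\le i\le n$, extended additively, and is applied componentwise to tuples. -}

module Defs where

open import Data.Nat using (ℕ; zero; suc; _+_; _*_; _∸_; _≤_; _<_; _≤ᵇ_; _⊓_)
open import Data.Bool using (Bool; true; false; if_then_else_; _∧_)
open import Data.Fin using (Fin; toℕ)
open import Data.Vec using (Vec; []; _∷_; lookup; count)
open import Data.List using (List; []; _∷_; map; _++_; filterᵇ; foldr)
open import Data.Fin.Subset using (Subset; ∣_∣)
open import Data.Nat using (_≡ᵇ_)
open import Relation.Binary.PropositionalEquality using (_≡_)
import Data.Fin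
import Data.Nat
import Relation.Nullary

Σ : ∀ {m} → (Fin m → ℕ) → ℕ
Σ {zero}  f = 0
Σ {suc m} f = f Data.Fin.zero + Σ {m} (λ i → f (Data.Fin.suc i))

allSubsets : ∀ k → List (Subset k)
allSubsets zero    = [] ∷ []
allSubsets (suc k) = map (true ∷_) (allSubsets k) ++ map (false ∷_) (allSubsets k)

-- all subsets of Fin k of cardinality ℓ, i.e. all choices 1 ≤ n₁ < … < n_ℓ ≤ k
subsetsOfSize : ∀ k → ℕ → List (Subset k)
subsetsOfSize k ℓ = filterᵇ (λ p → ∣ p ∣ ≡ᵇ ℓ) (allSubsets k)

sumOver : ∀ {k} → Subset k → (Fin k → ℕ) → ℕ
sumOver p f = Σ (λ i → if lookup p i then f i else 0)

-- minimum of a list, with a default value returned for the empty list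
-- (the default is always chosen ≥ every element, so it never affects
--  the minimum of a nonempty list)
minWith : ℕ → List ℕ → ℕ
minWith d = foldr _⊓_ d

-- min { F(S) : S ⊆ {1..k}, |S| = ℓ }  for F(S) = Σ_{i∈S} f i.
-- The default Σ_{all i} f i is ≥ every such value; for 1 ≤ ℓ ≤ k the
-- list is nonempty anyway.
minSubsetSum : ∀ {k} → ℕ → (Fin k → ℕ) → ℕ
minSubsetSum {k} ℓ f = minWith (Σ f) (map (λ p → sumOver p f) (subsetsOfSize k ℓ))

-- element of 𝒫⁺ (coordinates ω_i^*), indices 1..n encoded as Fin n (0-based)
𝓟⁺ : ℕ → Set
𝓟⁺ n = Fin n → ℕ

Tuple : ℕ → ℕ → Set
Tuple n k = Fin k → 𝓟⁺ n

tupleSum : ∀ {n k} → Tuple n k → 𝓟⁺ n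
tupleSum lam t = Σ (λ a → lam a t)

InP⁺ : ∀ {n k} → 𝓟⁺ n → Tuple n k → Set
InP⁺ lam lams = ∀ t → tupleSum lams t ≡ lam t

-- Σ_{t=i}^{j} ω_t^*(ν), with i, j 1-based
intervalSum : ∀ {n} → ℕ → ℕ → 𝓟⁺ n → ℕ
intervalSum i j ν = Σ (λ t → if (i ≤ᵇ suc (toℕ t)) ∧ (suc (toℕ t) ≤ᵇ j) then ν t else 0)

-- r_{(i,j),ℓ}(𝛌) = min { Σ_{t=i}^j ω_t^*(λ_{n₁}+…+λ_{n_ℓ}) : n₁<…<n_ℓ }
-- (ω_t^* is additive, so this is the min over ℓ-subsets of the sum of
--  the individual values)
r-int : ∀ {n k} → ℕ → ℕ → ℕ → Tuple n k → ℕ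
r-int i j ℓ lams = minSubsetSum ℓ (λ a → intervalSum i j (lams a))

_⊴_ : ∀ {n k} → Tuple n k → Tuple n k → Set
_⊴_ {n} {k} lams mus =
  ∀ i j ℓ → 1 ≤ i → i ≤ j → j ≤ n → 1 ≤ ℓ → ℓ ≤ k →
  r-int i j ℓ lams ≤ r-int i j ℓ mus

-- The simple Lie algebras A_n, C_n, B_{n+1}, D_{n+2} (Bourbaki labelling)

data CartanType : Set where
  A C B D : CartanType

-- 𝔤 t n is of type A_n, C_n, B_{n+1}, D_{n+2} respectively; its rank:
rank : CartanType → ℕ → ℕ
rank A n = n
rank C n = n
rank B n = suc n
rank D n = suc (suc n)

-- dominant integral weights of 𝔤, in the basis of fundamental weights ϖ_i
P⁺ : CartanType → ℕ → Set
P⁺ t n = Fin (rank t n) → ℕ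

WTuple : CartanType → ℕ → ℕ → Set
WTuple t n k = Fin k → P⁺ t n

ind : ℕ → ℕ → ℕ → ℕ
ind a b x = if (a ≤ᵇ x) ∧ (x ≤ᵇ b) then 1 else 0

-- Positive roots α of 𝔤 (hence positive coroots h_α), indexed by the usual
-- ε-description; m = rank, indices 1-based.
data PosRoot : CartanType → ℕ → Set where
  -- A_n : α_i + … + α_j , 1 ≤ i ≤ j ≤ n
  A-root    : ∀ {n} i j → 1 ≤ i → i ≤ j → j ≤ n → PosRoot A n
  -- ε_i − ε_j (i < j) in types C, B, D
  minus-C   : ∀ {n} i j → 1 ≤ i → i < j → j ≤ n → PosRoot C n
  minus-B   : ∀ {n} i j → 1 ≤ i → i < j → j ≤ suc n → PosRoot B n
  minus-D   : ∀ {n} i j → 1 ≤ i → i < j → j ≤ suc (suc n) → PosRoot D n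
  -- ε_i + ε_j (i < j) in types C, B, D
  plus-C    : ∀ {n} i j → 1 ≤ i → i < j → j ≤ n → PosRoot C n
  plus-B    : ∀ {n} i j → 1 ≤ i → i < j → j ≤ suc n → PosRoot B n
  plus-D    : ∀ {n} i j → 1 ≤ i → i < j → j ≤ suc (suc n) → PosRoot D n
  -- 2ε_i in type C_n, ε_i in type B_{n+1}
  long-C    : ∀ {n} i → 1 ≤ i → i ≤ n → PosRoot C n
  short-B   : ∀ {n} i → 1 ≤ i → i ≤ suc n → PosRoot B n

-- coefficient of the simple coroot α_x^∨ (x 1-based) in the coroot h_α.
--  * C_n: coroots form a root system of type B_n:
--      (ε_i−ε_j)^∨ = α_i^∨+…+α_{j−1}^∨,
--      (ε_i+ε_j)^∨ = α_i^∨+…+α_{j−1}^∨ + 2(α_j^∨+…+α_n^∨),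
--      (2ε_i)^∨    = α_i^∨+…+α_n^∨.
--  * B_m (m = n+1): coroots form a root system of type C_m:
--      (ε_i−ε_j)^∨ = α_i^∨+…+α_{j−1}^∨,
--      (ε_i+ε_j)^∨ = α_i^∨+…+α_{j−1}^∨ + 2(α_j^∨+…+α_{m−1}^∨) + α_m^∨,
--      (ε_i)^∨     = 2(α_i^∨+…+α_{m−1}^∨) + α_m^∨.
--  * D_m (m = n+2), simply laced:
--      ε_i−ε_j = α_i+…+α_{j−1},
--      ε_i+ε_m = α_i+…+α_{m−2} + α_m,
--      ε_i+ε_j = α_i+…+α_{j−1} + 2(α_j+…+α_{m−2}) + α_{m−1} + α_m  (j < m).
corootCoeff : ∀ {t n} → PosRoot t n → ℕ → ℕ
corootCoeff (A-root i j _ _ _) x = ind i j x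
corootCoeff {n = n} (minus-C i j _ _ _) x = ind i (j ∸ 1) x
corootCoeff {n = n} (minus-B i j _ _ _) x = ind i (j ∸ 1) x
corootCoeff {n = n} (minus-D i j _ _ _) x = ind i (j ∸ 1) x
corootCoeff {n = n} (plus-C i j _ _ _) x = ind i (j ∸ 1) x + 2 * ind j n x
corootCoeff {n = n} (plus-B i j _ _ _) x =
  ind i (j ∸ 1) x + 2 * ind j n x + ind (suc n) (suc n) x
corootCoeff {n = n} (plus-D i j _ _ _) x =
  if j ≡ᵇ suc (suc n)
  then ind i n x + ind (suc (suc n)) (suc (suc n)) x
  else ind i (j ∸ 1) x + 2 * ind j n x + ind (suc n) (suc n) x
                       + ind (suc (suc n)) (suc (suc n)) x
corootCoeff {n = n} (long-C i _ _) x = ind i n x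
corootCoeff {n = n} (short-B i _ _) x = 2 * ind i n x + ind (suc n) (suc n) x

-- ν(h_α) for ν = Σ_x ν_x ϖ_x  (ϖ_x(α_y^∨) = δ_{xy})
pair : ∀ {t n} → P⁺ t n → PosRoot t n → ℕ
pair ν α = Σ (λ x → ν x * corootCoeff α (suc (toℕ x)))

-- r_{α,ℓ}(𝛎) = min { (ν_{i₁}+…+ν_{i_ℓ})(h_α) : i₁<…<i_ℓ }
-- (pairing with h_α is additive)
r-root : ∀ {t n k} → PosRoot t n → ℕ → WTuple t n k → ℕ
r-root α ℓ νs = minSubsetSum ℓ (λ a → pair (νs a) α)

_≼_ : ∀ {t n k} → WTuple t n k → WTuple t n k → Set
_≼_ {t} {n} {k} νs ηs =
  ∀ (α : PosRoot t n) ℓ → 1 ≤ ℓ → ℓ ≤ k → r-root α ℓ νs ≤ r-root α ℓ ηs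

-- ι : 𝒫⁺ → P⁺,  ω_i ↦ ϖ_i (1 ≤ i ≤ n), extended additively

ιfun : ∀ {n m} → (Fin n → ℕ) → Fin m → ℕ
ιfun {n} lam x with Data.Fin.toℕ x Data.Nat.<? n
... | Relation.Nullary.yes p = lam (Data.Fin.fromℕ< p)
... | Relation.Nullary.no _  = 0

ι : ∀ {t n} → 𝓟⁺ n → P⁺ t n
ι {t} {n} lam = ιfun {n} {rank t n} lam

ιᵗ : ∀ {t n k} → Tuple n k → WTuple t n k
ιᵗ {t} lams a = ι {t} (lams a)

-- For 1 ≤ i ≤ j ≤ n the coroot α_i^∨ + … + α_j^∨ is a positive coroot of 𝔤 in each of
-- the types A_n, C_n, B_{n+1}, D_{n+2} (of ε_i − ε_{j+1}, or of 2ε_i when j = n in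
-- type C), and ι ν pairs with it to Σ_{t=i}^j ω_t^*(ν).  Hence r_{(i,j),ℓ} = r_{α,ℓ} ∘ ι,
-- so each inequality defining ⊴ is one of those defining ≼.
module Submission where

open import Defs
open import Data.Nat using (ℕ; zero; suc; _+_; _*_; _≤_; _<_; _≤ᵇ_; s≤s; z≤n; _<?_)
open import Data.Nat.Properties
  using (+-identityʳ; +-assoc; *-identityʳ; *-zeroʳ; ≤-refl; ≤-reflexive; ≤-trans; ≤⇒≯;
         n≤1+n; m≤n⇒m≤1+n; m≤n⇒m<n∨m≡n)
open import Data.Bool using (true; false; if_then_else_; _∧_)
open import Data.Fin using (Fin; toℕ; inject₁; fromℕ; fromℕ<)
open import Data.Fin.Properties using (toℕ-inject₁; toℕ-fromℕ; toℕ-fromℕ<; toℕ-injective; toℕ<n)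
open import Data.List.Properties using (map-cong)
open import Data.Vec using (lookup)
open import Data.Product using (Σ-syntax; _,_)
open import Data.Sum using (inj₁; inj₂)
open import Data.Empty using (⊥-elim)
open import Relation.Nullary using (yes; no)
open import Relation.Binary.PropositionalEquality
open ≡-Reasoning

Σ-cong : ∀ {m} {f g : Fin m → ℕ} → (∀ x → f x ≡ g x) → Σ f ≡ Σ g
Σ-cong {zero}  f≗g = refl
Σ-cong {suc m} f≗g = cong₂ _+_ (f≗g Data.Fin.zero) (Σ-cong (λ x → f≗g (Data.Fin.suc x)))

Σ-last : ∀ {m} (f : Fin (suc m) → ℕ) → Σ f ≡ Σ (λ x → f (inject₁ x)) + f (fromℕ m)
Σ-last {zero}  f = +-identityʳ _
Σ-last {suc m} f = begin
  f Data.Fin.zero + Σ (λ x → f (Data.Fin.suc x))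
    ≡⟨ cong (f Data.Fin.zero +_) (Σ-last (λ x → f (Data.Fin.suc x))) ⟩
  f Data.Fin.zero + (Σ (λ x → f (Data.Fin.suc (inject₁ x))) + f (fromℕ (suc m)))
    ≡⟨ +-assoc (f Data.Fin.zero) _ _ ⟨
  Σ (λ x → f (inject₁ x)) + f (fromℕ (suc m)) ∎

minSubsetSum-cong : ∀ {k} ℓ {f g : Fin k → ℕ} → (∀ a → f a ≡ g a) →
  minSubsetSum ℓ f ≡ minSubsetSum ℓ g
minSubsetSum-cong {k} ℓ f≗g = cong₂ minWith (Σ-cong f≗g) (map-cong sumOver-cong (subsetsOfSize k ℓ))
  where
  sumOver-cong : ∀ p → sumOver p _ ≡ sumOver p _
  sumOver-cong p = Σ-cong (λ i → cong (λ z → if lookup p i then z else 0) (f≗g i))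

ιfun-< : ∀ {n m} (ν : Fin n → ℕ) (x : Fin m) (y : Fin n) → toℕ x ≡ toℕ y → ιfun ν x ≡ ν y
ιfun-< {n} ν x y x≡y with toℕ x <? n
... | yes x<n = cong ν (toℕ-injective (trans (toℕ-fromℕ< x<n) x≡y))
... | no  x≮n = ⊥-elim (x≮n (subst (_< n) (sym x≡y) (toℕ<n y)))

ιfun-≥ : ∀ {n m} (ν : Fin n → ℕ) (x : Fin m) → n ≤ toℕ x → ιfun ν x ≡ 0
ιfun-≥ {n} ν x n≤x with toℕ x <? n
... | yes x<n = ⊥-elim (≤⇒≯ n≤x x<n)
... | no  _   = refl

ιfun-inject₁ : ∀ {n m} (ν : Fin n → ℕ) (x : Fin m) → ιfun {m = suc m} ν (inject₁ x) ≡ ιfun ν x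
ιfun-inject₁ {n} ν x with toℕ x <? n
... | yes x<n = ιfun-< ν (inject₁ x) (fromℕ< x<n) (trans (toℕ-inject₁ x) (sym (toℕ-fromℕ< x<n)))
... | no  x≮n with toℕ (inject₁ x) <? n
...   | yes x<n = ⊥-elim (x≮n (subst (_< n) (toℕ-inject₁ x) x<n))
...   | no  _   = refl

Σ-ιfun : ∀ {n m} → n ≤ m → (ν : Fin n → ℕ) (c : ℕ → ℕ) →
  Σ {m} (λ x → ιfun ν x * c (toℕ x)) ≡ Σ {n} (λ y → ν y * c (toℕ y))
Σ-ιfun {m = zero} z≤n ν c = refl
Σ-ιfun {n} {suc m} n≤1+m ν c with m≤n⇒m<n∨m≡n n≤1+m
... | inj₂ refl = Σ-cong (λ x → cong (_* c (toℕ x)) (ιfun-< ν x x refl))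
... | inj₁ (s≤s n≤m) = begin
  Σ {suc m} term
    ≡⟨ Σ-last term ⟩
  Σ {m} (λ x → term (inject₁ x)) + term (fromℕ m)
    ≡⟨ cong₂ _+_ (Σ-cong {m} shrink) (cong (_* c (toℕ (fromℕ m))) last≡0) ⟩
  Σ {m} term + 0
    ≡⟨ +-identityʳ _ ⟩
  Σ {m} term
    ≡⟨ Σ-ιfun n≤m ν c ⟩
  Σ (λ y → ν y * c (toℕ y)) ∎
  where
  term : ∀ {m} → Fin m → ℕ
  term x = ιfun ν x * c (toℕ x)
  shrink : ∀ x → term (inject₁ x) ≡ term x
  shrink x = cong₂ _*_ (ιfun-inject₁ ν x) (cong c (toℕ-inject₁ x))
  last≡0 : ιfun ν (fromℕ m) ≡ 0
  last≡0 = ιfun-≥ ν (fromℕ m) (≤-trans n≤m (≤-reflexive (sym (toℕ-fromℕ m))))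

*-ind : ∀ a b x m → m * ind a b x ≡ (if (a ≤ᵇ x) ∧ (x ≤ᵇ b) then m else 0)
*-ind a b x m with (a ≤ᵇ x) ∧ (x ≤ᵇ b)
... | true  = *-identityʳ m
... | false = *-zeroʳ m

n≤rank : ∀ t n → n ≤ rank t n
n≤rank A n = ≤-refl
n≤rank C n = ≤-refl
n≤rank B n = n≤1+n n
n≤rank D n = m≤n⇒m≤1+n (n≤1+n n)

pair-ι-interval : ∀ {t n} (α : PosRoot t n) i j → (∀ x → corootCoeff α x ≡ ind i j x) →
  (ν : 𝓟⁺ n) → pair (ι {t} ν) α ≡ intervalSum i j ν
pair-ι-interval {t} {n} α i j α≗ij ν = begin
  Σ {rank t n} (λ x → ιfun ν x * corootCoeff α (suc (toℕ x)))
    ≡⟨ Σ-cong {rank t n} (λ x → cong (ιfun ν x *_) (α≗ij (suc (toℕ x)))) ⟩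
  Σ {rank t n} (λ x → ιfun ν x * ind i j (suc (toℕ x)))
    ≡⟨ Σ-ιfun (n≤rank t n) ν (λ x → ind i j (suc x)) ⟩
  Σ (λ y → ν y * ind i j (suc (toℕ y)))
    ≡⟨ Σ-cong {n} (λ y → *-ind i j (suc (toℕ y)) (ν y)) ⟩
  intervalSum i j ν ∎

intervalCoroot : ∀ t n i j → 1 ≤ i → i ≤ j → j ≤ n →
  Σ[ α ∈ PosRoot t n ] (∀ x → corootCoeff α x ≡ ind i j x)
intervalCoroot A n i j 1≤i i≤j j≤n = A-root i j 1≤i i≤j j≤n , λ _ → refl
intervalCoroot C n i j 1≤i i≤j j≤n with m≤n⇒m<n∨m≡n j≤n
... | inj₁ j<n  = minus-C i (suc j) 1≤i (s≤s i≤j) j<n , λ _ → refl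
... | inj₂ refl = long-C i 1≤i i≤j , λ _ → refl
intervalCoroot B n i j 1≤i i≤j j≤n = minus-B i (suc j) 1≤i (s≤s i≤j) (s≤s j≤n) , λ _ → refl
intervalCoroot D n i j 1≤i i≤j j≤n =
  minus-D i (suc j) 1≤i (s≤s i≤j) (s≤s (m≤n⇒m≤1+n j≤n)) , λ _ → refl

r-root-ι-interval : ∀ {t n k} (α : PosRoot t n) i j → (∀ x → corootCoeff α x ≡ ind i j x) →
  ∀ ℓ (lams : Tuple n k) → r-root α ℓ (ιᵗ {t} lams) ≡ r-int i j ℓ lams
r-root-ι-interval α i j α≗ij ℓ lams =
  minSubsetSum-cong ℓ (λ a → pair-ι-interval α i j α≗ij (lams a))

corollary3p1 : (t : CartanType) (n : ℕ) → 1 ≤ n →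
    (lam : 𝓟⁺ n) (k : ℕ) → 1 ≤ k →
    (lams mus : Tuple n k) → InP⁺ lam lams → InP⁺ lam mus →
    _≼_ {t} (ιᵗ {t} lams) (ιᵗ {t} mus) → lams ⊴ mus
corollary3p1 t n _ _ k _ lams mus _ _ ιlams≼ιmus i j ℓ 1≤i i≤j j≤n 1≤ℓ ℓ≤k
  with intervalCoroot t n i j 1≤i i≤j j≤n
... | α , α≗ij =
  subst₂ _≤_ (r-root-ι-interval α i j α≗ij ℓ lams) (r-root-ι-interval α i j α≗ij ℓ mus)
    (ιlams≼ιmus α ℓ 1≤ℓ ℓ≤k)
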